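{- For every connected graph $G\neq C_5$ with at least one edge and maximum degree $\Delta$, it holds that $\chi_o(G)\le 2\Delta$.
   Context: All graphs are finite, simple and undirected. A proper vertex coloring $\varphi$ of a graph $G$ is called an odd coloring if for every non-isolated vertex $x$ of $G$ there is a color $c$ such that the number of neighbors $y\in N(x)$ with $\varphi(y)=c$ is odd. The odd chromatic number $\chi_o(G)$ is the minimum number of colors in an odd coloring of $G$. -}

module Defs where

open import Data.Nat using (ℕ; zero; suc; _+_; _*_; _⊔_)
open import Data.Nat.Properties using ()
open import Data.Bool using (Bool; true; false; _∧_; _∨_)
open import Data.Fin using (Fin; toℕ)
open import Data.Fin.Properties using ()
open import Data.List using (List; []; _∷_; foldr; map; filter; length; allFin)
open import Data.Product using (Σ; ∃; ∃-syntax; _×_; _,_)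
open import Relation.Binary.PropositionalEquality using (_≡_; _≢_)
open import Relation.Nullary using (¬_)
open import Data.Fin using (_≟_)
open import Relation.Nullary.Decidable using (⌊_⌋)
open import Function.Bundles using (_↔_; Inverse)
open import Data.Nat using (_≡ᵇ_)

record Graph (n : ℕ) : Set where
  field
    adj    : Fin n → Fin n → Bool
    sym    : ∀ x y → adj x y ≡ adj y x
    irrefl : ∀ x → adj x x ≡ false
open Graph public

countFin : ∀ {n} → (Fin n → Bool) → ℕ
countFin {n} p = length (filter (λ y → p y Data.Bool.≟ true) (allFin n))

deg : ∀ {n} → Graph n → Fin n → ℕ
deg G x = countFin (adj G x)

maxDeg : ∀ {n} → Graph n → ℕ
maxDeg {n} G = foldr _⊔_ 0 (map (deg G) (allFin n))

data Walk {n} (G : Graph n) : Fin n → Fin n → Set where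
  here : ∀ {x} → Walk G x x
  step : ∀ {x y z} → adj G x y ≡ true → Walk G y z → Walk G x z

Connected : ∀ {n} → Graph n → Set
Connected {n} G = ∀ (x y : Fin n) → Walk G x y

HasEdge : ∀ {n} → Graph n → Set
HasEdge G = ∃[ x ] ∃[ y ] adj G x y ≡ true

NonIsolated : ∀ {n} → Graph n → Fin n → Set
NonIsolated G x = ∃[ y ] adj G x y ≡ true

c5adj : Fin 5 → Fin 5 → Bool
c5adj i j = (((toℕ i + 1) Data.Nat.% 5) ≡ᵇ toℕ j) ∨ (((toℕ j + 1) Data.Nat.% 5) ≡ᵇ toℕ i)

IsoC5 : ∀ {n} → Graph n → Set
IsoC5 {n} G = Σ (Fin n ↔ Fin 5) λ f →
  ∀ x y → adj G x y ≡ c5adj (Inverse.to f x) (Inverse.to f y)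

nbrsWithColour : ∀ {n k} → Graph n → (Fin n → Fin k) → Fin n → Fin k → ℕ
nbrsWithColour G φ x c = countFin (λ y → adj G x y ∧ ⌊ φ y ≟ c ⌋)

data Odd : ℕ → Set where
  one  : Odd 1
  plus2 : ∀ {m} → Odd m → Odd (suc (suc m))

IsOddColouring : ∀ {n k} → Graph n → (Fin n → Fin k) → Set
IsOddColouring {n} G φ =
  (∀ x y → adj G x y ≡ true → φ x ≢ φ y) ×
  (∀ x → NonIsolated G x → ∃[ c ] Odd (nbrsWithColour G φ x c))

-- χ_o(G) ≤ k  iff  G has an odd colouring using colours from a k-element set
OddChromaticLe : ∀ {n} → Graph n → ℕ → Set
OddChromaticLe G k = ∃[ φ ] IsOddColouring {k = k} G φ

module Submission where

-- Colour greedily, giving each vertex v a colour that differs from those of its coloured neighbours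
-- and, for each neighbour x all of whose neighbours are then coloured, from one odd colour class
-- among the other neighbours of x, if there is one: that class stays odd, and if there is none the
-- class of v's colour becomes odd. At most 2 deg v colours are forbidden, and fewer than 2Δ once v
-- has an uncoloured neighbour or a neighbour with one; colouring towards a final vertex w along
-- walks ensures this for every v other than w. If n ≤ 2Δ an injective colouring works. Otherwise w
-- is taken of degree below Δ; in a Δ-regular graph with Δ ≥ 3 it is the centre of an induced path
-- p w q whose ends are precoloured alike, so w again sees fewer than 2Δ colours. For Δ = 2 the graph
-- is a cycle, and a similar precolouring works unless it is C₅.

open import Defs hiding (sym)
open import Data.Nat using (ℕ; zero; suc; _+_; _*_; _⊔_; _≤_; _<_; _≤?_; _<?_; z≤n; s≤s)
open import Data.Nat using () renaming (_≟_ to _≟ℕ_)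
open import Data.Nat.Properties
  using (≤-refl; ≤-reflexive; ≤-trans; ≤-<-trans; <-≤-trans; ≤-antisym; <⇒≤; <⇒≱; ≰⇒>; ≮⇒≥; ≤∧≢⇒<;
         m≤m+n; m≤m⊔n; m≤n⊔m; +-mono-≤; +-mono-<-≤; +-mono-≤-<; suc-injective; +-commutativeSemigroup;
         module ≤-Reasoning)
open import Data.Bool using (Bool; true; false; _∧_; not; if_then_else_)
import Data.Bool as Bool
open import Data.Bool.Properties using (∧-assoc; ∧-identityʳ; ∧-zeroʳ)
open import Data.Fin using (Fin; zero; suc; _≟_; inject≤)
open import Data.Fin.Properties using (any?; all?; inject≤-injective)
open import Data.List using (List; []; _∷_; length; map; filter; allFin; tabulate; foldr; _++_; concatMap)
open import Data.List.Properties using (length-filter; filter-notAll; length-tabulate; length-++; length-map)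
open import Data.List.Relation.Unary.Any using (here; there)
open import Data.List.Relation.Unary.AllPairs using ([]; _∷_)
open import Data.List.Relation.Unary.All using ([]; _∷_)
import Data.List.Relation.Unary.All as All
open import Data.List.Relation.Unary.Unique.Propositional using (Unique)
import Data.List.Relation.Unary.Unique.Propositional.Properties as Unique
open import Data.List.Membership.Propositional using (_∈_; _∉_; lose)
open import Data.List.Membership.Propositional.Properties
  using (∈-filter⁺; ∈-filter⁻; ∈-allFin; ∈-map⁺; ∈-++⁺ˡ; ∈-++⁺ʳ; ∈-concatMap⁺;
         ∈-tabulate⁺; ∈-tabulate⁻)
import Data.List.Relation.Unary.Any as Any
open import Data.Product using (∃-syntax; _×_; _,_; proj₁; proj₂)
import Data.Product
open import Data.Sum using (_⊎_; inj₁; inj₂)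
import Data.Sum
open import Data.Empty using (⊥)
open import Function using (_∘_; _$_)
open import Function.Bundles using (mk↔ₛ′)
open import Algebra.Properties.CommutativeSemigroup +-commutativeSemigroup using (x∙yz≈y∙xz)
open import Relation.Nullary using (¬_; Dec; yes; no; does; contradiction; ¬?)
open import Relation.Nullary.Decidable
  using (⌊_⌋; dec-true; dec-false; decidable-stable; isYes≗does; from-yes; _⊎-dec_; _×-dec_; _→-dec_)
open import Relation.Unary using (Decidable)
open import Relation.Binary.PropositionalEquality
  using (_≡_; _≢_; refl; sym; trans; cong; cong₂; subst; subst₂; module ≡-Reasoning)

infix 4 _∈?_
_∈?_ : ∀ {n} (y : Fin n) xs → Dec (y ∈ xs)
y ∈? xs = Any.any? (y ≟_) xs

does⇒ : ∀ {A : Set} (a? : Dec A) → does a? ≡ true → A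
does⇒ (yes a) _ = a

∧≡true : ∀ {a b} → a ∧ b ≡ true → a ≡ true × b ≡ true
∧≡true {true} {true} _ = refl , refl

full empty : ∀ {n} → Fin n → Bool
full _ = true
empty _ = false

⟦_⟧ : ∀ {n} → List (Fin n) → Fin n → Bool
⟦ xs ⟧ y = does (y ∈? xs)

-- `does` rather than ⌊_⌋, which does not reduce on suc x ≟ suc y.
_─_ : ∀ {n} → (Fin n → Bool) → Fin n → Fin n → Bool
(p ─ v) y = p y ∧ not (does (y ≟ v))

_⊆ᵇ_ : ∀ {n} → (Fin n → Bool) → (Fin n → Bool) → Set
R ⊆ᵇ S = ∀ y → R y ≡ true → S y ≡ true

─-true : ∀ {n} {R : Fin n → Bool} {v y} → R y ≡ true → y ≢ v → (R ─ v) y ≡ true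
─-true {v = v} {y} Ry y≢v = cong₂ (λ a b → a ∧ not b) Ry (dec-false (y ≟ v) y≢v)

─-true⁻ : ∀ {n} {R : Fin n → Bool} {v y} → (R ─ v) y ≡ true → R y ≡ true × y ≢ v
─-true⁻ {R = R} {v} {y} R-vy with R y | y ≟ v
... | true | no y≢v = refl , y≢v

─⊆ : ∀ {n} (R : Fin n → Bool) v → (R ─ v) ⊆ᵇ R
─⊆ R v y = proj₁ ∘ ─-true⁻ {R = R}

─-self : ∀ {n} (R : Fin n → Bool) v → (R ─ v) v ≡ false
─-self R v = trans (cong (λ b → R v ∧ not b) (dec-true (v ≟ v) refl)) (∧-zeroʳ (R v))

iverson : Bool → ℕ
iverson true = 1
iverson false = 0

count : ∀ {n} → (Fin n → Bool) → ℕ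
count {zero} p = 0
count {suc n} p = iverson (p zero) + count (p ∘ suc)

count-cong : ∀ {n} {p q : Fin n → Bool} → (∀ y → p y ≡ q y) → count p ≡ count q
count-cong {zero} p≗q = refl
count-cong {suc n} p≗q = cong₂ _+_ (cong iverson (p≗q zero)) (count-cong (p≗q ∘ suc))

count-remove : ∀ {n} (p : Fin n → Bool) v → count p ≡ iverson (p v) + count (p ─ v)
count-remove {suc n} p zero = cong (iverson (p zero) +_) (begin
  count (p ∘ suc)
    ≡⟨ count-cong (λ y → sym (∧-identityʳ (p (suc y)))) ⟩
  count ((p ─ zero) ∘ suc)
    ≡⟨ cong (λ b → iverson b + count ((p ─ zero) ∘ suc)) (∧-zeroʳ (p zero)) ⟨
  iverson ((p ─ zero) zero) + count ((p ─ zero) ∘ suc) ∎)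
  where open ≡-Reasoning
count-remove {suc n} p (suc v) = begin
  iverson (p zero) + count (p ∘ suc)
    ≡⟨ cong (iverson (p zero) +_) (count-remove (p ∘ suc) v) ⟩
  iverson (p zero) + (iverson (p (suc v)) + count ((p ∘ suc) ─ v))
    ≡⟨ x∙yz≈y∙xz (iverson (p zero)) (iverson (p (suc v))) (count ((p ∘ suc) ─ v)) ⟩
  iverson (p (suc v)) + (iverson (p zero) + count ((p ∘ suc) ─ v))
    ≡⟨ cong (λ b → iverson (p (suc v)) + (iverson b + count ((λ y → p (suc y)) ─ v)))
            (∧-identityʳ (p zero)) ⟨
  iverson (p (suc v)) + count (p ─ suc v) ∎
  where open ≡-Reasoning

count-false : ∀ {n} {p : Fin n → Bool} → (∀ y → p y ≡ false) → count p ≡ 0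
count-false {zero} _ = refl
count-false {suc n} none = cong₂ _+_ (cong iverson (none zero)) (count-false (none ∘ suc))

count-≡1 : ∀ {n} {p : Fin n → Bool} {u} → p u ≡ true → (∀ y → p y ≡ true → y ≡ u) → count p ≡ 1
count-≡1 {p = p} {u} pu only = begin
  count p                     ≡⟨ count-remove p u ⟩
  iverson (p u) + count (p ─ u) ≡⟨ cong₂ (λ a m → iverson a + m) pu (count-false none) ⟩
  1                           ∎
  where
  open ≡-Reasoning
  none : ∀ y → (p ─ u) y ≡ false
  none y with p y in py | y ≟ u
  ... | false | _ = refl
  ... | true | yes _ = refl
  ... | true | no y≢u = contradiction (only y py) y≢u

countFin≡count : ∀ {n} (p : Fin n → Bool) → countFin p ≡ count p
countFin≡count {n} p = go (λ y → y)
  where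
  go : ∀ {m} (f : Fin m → Fin n) → length (filter (λ y → p y Bool.≟ true) (tabulate f)) ≡ count (p ∘ f)
  go {zero} f = refl
  go {suc m} f with p (f zero)
  ... | true = cong suc (go (f ∘ suc))
  ... | false = go (f ∘ suc)

Unique∧⊆⇒length≤ : ∀ {n} {xs ys : List (Fin n)} → Unique xs → (∀ {x} → x ∈ xs → x ∈ ys) →
  length xs ≤ length ys
Unique∧⊆⇒length≤ {xs = []} _ _ = z≤n
Unique∧⊆⇒length≤ {xs = x ∷ xs} {ys} (x≢xs ∷ unique) xs⊆ys = begin-strict
  length xs                         ≤⟨ Unique∧⊆⇒length≤ unique xs⊆ys-x ⟩
  length (filter (¬? ∘ (x ≟_)) ys)  <⟨ filter-notAll (¬? ∘ (x ≟_)) ys (lose (xs⊆ys (here refl)) (_$ refl)) ⟩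
  length ys                         ∎
  where
  open ≤-Reasoning
  xs⊆ys-x : ∀ {y} → y ∈ xs → y ∈ filter (¬? ∘ (x ≟_)) ys
  xs⊆ys-x y∈xs = ∈-filter⁺ (¬? ∘ (x ≟_)) (xs⊆ys (there y∈xs)) (All.lookup x≢xs y∈xs)

complete-list-length : ∀ {n} {xs : List (Fin n)} → (∀ i → i ∈ xs) → n ≤ length xs
complete-list-length {n} {xs} complete =
  subst (_≤ length xs) (length-tabulate (λ i → i))
        (Unique∧⊆⇒length≤ (Unique.allFin⁺ n) (λ {i} _ → complete i))

short-list-misses : ∀ {k} (xs : List (Fin k)) → length xs < k → ∃[ c ] c ∉ xs
short-list-misses xs short with any? (λ c → ¬? (c ∈? xs))
... | yes missed = missed
... | no none = contradiction (complete-list-length λ c → decidable-stable (c ∈? xs) λ c∉xs → none (c , c∉xs))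
                              (<⇒≱ short)

≤-foldr-⊔ : ∀ {x xs} → x ∈ xs → x ≤ foldr _⊔_ 0 xs
≤-foldr-⊔ {xs = y ∷ xs} (here refl) = m≤m⊔n y _
≤-foldr-⊔ {xs = y ∷ xs} (there x∈xs) = ≤-trans (≤-foldr-⊔ x∈xs) (m≤n⊔m y _)

sum<double : ∀ {a b m} → a ≤ m → b ≤ m → a < m ⊎ b < m → a + b < 2 * m
sum<double {m = m} a≤m b≤m (inj₁ a<m) = +-mono-<-≤ a<m (≤-trans b≤m (m≤m+n m 0))
sum<double {m = m} a≤m b≤m (inj₂ b<m) = +-mono-≤-< a≤m (<-≤-trans b<m (m≤m+n m 0))

odd? : ∀ m → Dec (Odd m)
odd? zero = no λ ()
odd? (suc zero) = yes one
odd? (suc (suc m)) with odd? m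
... | yes odd = yes (plus2 odd)
... | no even = no λ { (plus2 odd) → even odd }

¬odd⇒odd-suc : ∀ {m} → ¬ Odd m → Odd (suc m)
¬odd⇒odd-suc {zero} _ = one
¬odd⇒odd-suc {suc zero} even = contradiction one even
¬odd⇒odd-suc {suc (suc m)} even = plus2 (¬odd⇒odd-suc (even ∘ plus2))

module Neighbourhoods {n} (G : Graph n) where

  adj-sym : ∀ {x y b} → adj G x y ≡ b → adj G y x ≡ b
  adj-sym {x} {y} xy = trans (Graph.sym G y x) xy

  adj⇒≢ : ∀ {x y} → adj G x y ≡ true → x ≢ y
  adj⇒≢ {x} xy refl = contradiction (trans (sym (irrefl G x)) xy) λ ()

  neighbours : Fin n → List (Fin n)
  neighbours x = filter (λ y → adj G x y Bool.≟ true) (allFin n)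

  ∈-neighbours⁺ : ∀ {x y} → adj G x y ≡ true → y ∈ neighbours x
  ∈-neighbours⁺ {x} {y} = ∈-filter⁺ (λ y → adj G x y Bool.≟ true) (∈-allFin y)

  ∈-neighbours⁻ : ∀ {x y} → y ∈ neighbours x → adj G x y ≡ true
  ∈-neighbours⁻ {x} = proj₂ ∘ ∈-filter⁻ (λ y → adj G x y Bool.≟ true) {xs = allFin n}

  deg≤maxDeg : ∀ x → deg G x ≤ maxDeg G
  deg≤maxDeg x = ≤-foldr-⊔ (∈-map⁺ (deg G) (∈-allFin x))

  distinct-neighbours≤deg : ∀ {x xs} → Unique xs → (∀ {y} → y ∈ xs → adj G x y ≡ true) →
    length xs ≤ deg G x
  distinct-neighbours≤deg unique xs⊆N = Unique∧⊆⇒length≤ unique (∈-neighbours⁺ ∘ xs⊆N)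

  deg≤-of-neighbours⊆ : ∀ {x} xs → (∀ {y} → adj G x y ≡ true → y ∈ xs) → deg G x ≤ length xs
  deg≤-of-neighbours⊆ {x} xs N⊆xs =
    Unique∧⊆⇒length≤ (Unique.filter⁺ (λ y → adj G x y Bool.≟ true) {allFin n} (Unique.allFin⁺ n))
                     (N⊆xs ∘ ∈-neighbours⁻)

  deg≡2⇒neighbours : ∀ {x a b} → deg G x ≡ 2 → adj G x a ≡ true → adj G x b ≡ true → a ≢ b →
    ∀ {y} → adj G x y ≡ true → y ∈ a ∷ b ∷ []
  deg≡2⇒neighbours {x} {a} {b} deg≡2 xa xb a≢b {y} xy with y ∈? a ∷ b ∷ []
  ... | yes y∈ab = y∈ab
  ... | no y∉ab =
    contradiction (subst (3 ≤_) deg≡2 (distinct-neighbours≤deg unique aby⊆N)) λ { (s≤s (s≤s ())) }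
    where
    unique : Unique (a ∷ b ∷ y ∷ [])
    unique = (a≢b ∷ (λ a≡y → y∉ab (here (sym a≡y))) ∷ [])
           ∷ ((λ b≡y → y∉ab (there (here (sym b≡y)))) ∷ [])
           ∷ []
           ∷ []
    aby⊆N : ∀ {z} → z ∈ a ∷ b ∷ y ∷ [] → adj G x z ≡ true
    aby⊆N (here refl) = xa
    aby⊆N (there (here refl)) = xb
    aby⊆N (there (there (here refl))) = xy

  ∉-neighbours⇒nonadjacent : ∀ {x y} → y ∉ neighbours x → adj G x y ≡ false
  ∉-neighbours⇒nonadjacent {x} {y} y∉ with adj G x y in xy
  ... | true = contradiction (∈-neighbours⁺ xy) y∉
  ... | false = refl

  another-neighbour : ∀ {x} → 2 ≤ deg G x → ∀ a → ∃[ c ] adj G x c ≡ true × c ≢ a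
  another-neighbour {x} 2≤deg a with any? (λ c → (adj G x c Bool.≟ true) ×-dec ¬? (c ≟ a))
  ... | yes found = found
  ... | no none = contradiction (≤-trans 2≤deg (deg≤-of-neighbours⊆ (a ∷ []) only-a)) λ { (s≤s ()) }
    where
    only-a : ∀ {y} → adj G x y ≡ true → y ∈ a ∷ []
    only-a {y} xy = here (decidable-stable (y ≟ a) λ y≢a → none (y , xy , y≢a))

  crossing : ∀ {P : Fin n → Set} → Decidable P → ∀ {a b} → Walk G a b → P a → ¬ P b →
    ∃[ x ] ∃[ y ] adj G x y ≡ true × P x × ¬ P y
  crossing P? here Pa ¬Pb = contradiction Pa ¬Pb
  crossing P? {a} (step {y = a′} aa′ walk) Pa ¬Pb with P? a′
  ... | yes Pa′ = crossing P? walk Pa′ ¬Pb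
  ... | no ¬Pa′ = a , a′ , aa′ , Pa , ¬Pa′

  Cherry : Fin n → Fin n → Fin n → Set
  Cherry w p q = adj G w p ≡ true × adj G w q ≡ true × adj G p q ≡ false × p ≢ q

  cherry-at : Connected G → ∀ {a t} → t ∉ a ∷ neighbours a → ∃[ w ] ∃[ q ] Cherry w a q
  cherry-at conn {a} {t} t∉ with crossing (_∈? a ∷ neighbours a) (conn a t) (here refl) t∉
  ... | x , y , xy , here refl , y∉ = contradiction (there (∈-neighbours⁺ xy)) y∉
  ... | x , y , xy , there x∈ , y∉ =
    x , y , adj-sym (∈-neighbours⁻ x∈) , xy , ∉-neighbours⇒nonadjacent (y∉ ∘ there) ,
    λ { refl → y∉ (here refl) }

  1≤deg-of-edge : ∀ {x y} → adj G x y ≡ true → 1 ≤ deg G x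
  1≤deg-of-edge xy = distinct-neighbours≤deg ([] ∷ []) λ { (here refl) → xy }

  2≤deg-of-cherry : ∀ {w p q} → Cherry w p q → 2 ≤ deg G w
  2≤deg-of-cherry (wp , wq , _ , p≢q) =
    distinct-neighbours≤deg ((p≢q ∷ []) ∷ [] ∷ []) λ { (here refl) → wp ; (there (here refl)) → wq }

  closed-neighbourhood-short : 2 * maxDeg G < n → ∀ {x y} → adj G x y ≡ true → length (x ∷ neighbours x) < n
  closed-neighbourhood-short 2Δ<n {x} xy =
    ≤-<-trans (+-mono-≤ (≤-trans (1≤deg-of-edge xy) (deg≤maxDeg x)) (≤-trans (deg≤maxDeg x) (m≤m+n _ 0)))
              2Δ<n

  closed-list-complete : Connected G → ∀ {a xs} → a ∈ xs →
    (∀ {x y} → x ∈ xs → adj G x y ≡ true → y ∈ xs) → ∀ y → y ∈ xs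
  closed-list-complete conn {a} {xs} a∈xs closed y with y ∈? xs
  ... | yes y∈xs = y∈xs
  ... | no y∉xs with crossing (_∈? xs) (conn a y) a∈xs y∉xs
  ...   | u , v , uv , u∈xs , v∉xs = contradiction (closed u∈xs uv) v∉xs

module PartialColourings {n} (G : Graph n) {k : ℕ} where
  open Neighbourhoods G

  Finished : (Fin n → Bool) → Fin n → Set
  Finished R x = adj G x ⊆ᵇ R

  finished? : ∀ R → Decidable (Finished R)
  finished? R x = all? λ z → (adj G x z Bool.≟ true) →-dec (R z Bool.≟ true)

  Finished-mono : ∀ {R S x} → R ⊆ᵇ S → Finished R x → Finished S x
  Finished-mono R⊆S finished z xz = R⊆S z (finished z xz)

  IsPartialOddColouring : (Fin n → Bool) → (Fin n → Fin k) → Set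
  IsPartialOddColouring R φ =
    (∀ x y → R x ≡ true → R y ≡ true → adj G x y ≡ true → φ x ≢ φ y) ×
    (∀ x → NonIsolated G x → Finished R x → ∃[ e ] Odd (nbrsWithColour G φ x e))

  restrict : ∀ {R S φ} → R ⊆ᵇ S → IsPartialOddColouring S φ → IsPartialOddColouring R φ
  restrict R⊆S (proper , odd) =
    (λ x y Rx Ry → proper x y (R⊆S x Rx) (R⊆S y Ry)) ,
    (λ x nonisolated → odd x nonisolated ∘ Finished-mono R⊆S)

  finished-⟦⟧ : ∀ {xs x} → Finished ⟦ xs ⟧ x → ∀ {y} → adj G x y ≡ true → y ∈ xs
  finished-⟦⟧ {xs} finished {y} xy = does⇒ (y ∈? xs) (finished y xy)

  empty-precolouring : ∀ {φ} → IsPartialOddColouring empty φ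
  empty-precolouring = (λ _ _ ()) , λ { x (y , xy) finished → contradiction (finished y xy) λ () }

  pair-precolouring : ∀ {a b} c → adj G a b ≡ false → (∀ x → ¬ Finished ⟦ a ∷ b ∷ [] ⟧ x) →
    IsPartialOddColouring ⟦ a ∷ b ∷ [] ⟧ (λ _ → c)
  pair-precolouring {a} {b} c ab unfinished = proper , λ x _ finished → contradiction finished (unfinished x)
    where
    proper : ∀ x y → ⟦ a ∷ b ∷ [] ⟧ x ≡ true → ⟦ a ∷ b ∷ [] ⟧ y ≡ true → adj G x y ≡ true → c ≢ c
    proper x y Rx Ry xy _ with does⇒ (x ∈? a ∷ b ∷ []) Rx | does⇒ (y ∈? a ∷ b ∷ []) Ry
    ... | here refl | here refl = adj⇒≢ xy refl
    ... | here refl | there (here refl) = contradiction (trans (sym ab) xy) λ ()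
    ... | there (here refl) | here refl = contradiction (trans (sym ab) (adj-sym xy)) λ ()
    ... | there (here refl) | there (here refl) = adj⇒≢ xy refl

  _[_≔_] : (Fin n → Fin k) → Fin n → Fin k → Fin n → Fin k
  (φ [ v ≔ c ]) y = if does (y ≟ v) then c else φ y

  update-self : ∀ {φ v c} → (φ [ v ≔ c ]) v ≡ c
  update-self {v = v} rewrite dec-true (v ≟ v) refl = refl

  update-other : ∀ {φ v c y} → y ≢ v → (φ [ v ≔ c ]) y ≡ φ y
  update-other {v = v} {y = y} y≢v rewrite dec-false (y ≟ v) y≢v = refl

  colourClass : (Fin n → Fin k) → Fin n → Fin k → Fin n → Bool
  colourClass φ x e y = adj G x y ∧ does (φ y ≟ e)

  nbrsWithColourExcept : (Fin n → Fin k) → Fin n → Fin n → Fin k → ℕ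
  nbrsWithColourExcept φ x v e = count (colourClass φ x e ─ v)

  nbrsWithColour≡count : ∀ φ x e → nbrsWithColour G φ x e ≡ count (colourClass φ x e)
  nbrsWithColour≡count φ x e = trans (countFin≡count (λ y → adj G x y ∧ ⌊ φ y ≟ e ⌋))
                                     (count-cong (λ y → cong (adj G x y ∧_) (isYes≗does (φ y ≟ e))))

  nbrsWithColour-split : ∀ φ x v e →
    nbrsWithColour G φ x e ≡ iverson (colourClass φ x e v) + nbrsWithColourExcept φ x v e
  nbrsWithColour-split φ x v e = trans (nbrsWithColour≡count φ x e) (count-remove (colourClass φ x e) v)

  nbrsWithColourExcept-update : ∀ {φ v c x e} →
    nbrsWithColourExcept (φ [ v ≔ c ]) x v e ≡ nbrsWithColourExcept φ x v e
  nbrsWithColourExcept-update {φ} {v} {c} {x} {e} = count-cong same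
    where
    same : ∀ y → (colourClass (φ [ v ≔ c ]) x e ─ v) y ≡ (colourClass φ x e ─ v) y
    same y with y ≟ v
    ... | yes refl = trans (∧-zeroʳ _) (sym (∧-zeroʳ _))
    ... | no _ = refl

  nbrsWithColour-update-adjacent : ∀ {φ v c x e} → adj G x v ≡ true →
    nbrsWithColour G (φ [ v ≔ c ]) x e ≡ iverson (does (c ≟ e)) + nbrsWithColourExcept φ x v e
  nbrsWithColour-update-adjacent {φ} {v} {c} {x} {e} xv = begin
    nbrsWithColour G (φ [ v ≔ c ]) x e
      ≡⟨ nbrsWithColour-split (φ [ v ≔ c ]) x v e ⟩
    iverson (adj G x v ∧ does ((φ [ v ≔ c ]) v ≟ e)) + nbrsWithColourExcept (φ [ v ≔ c ]) x v e
      ≡⟨ cong₂ (λ a c′ → iverson (a ∧ does (c′ ≟ e)) + nbrsWithColourExcept (φ [ v ≔ c ]) x v e)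
               xv (update-self {φ} {v} {c}) ⟩
    iverson (does (c ≟ e)) + nbrsWithColourExcept (φ [ v ≔ c ]) x v e
      ≡⟨ cong (iverson (does (c ≟ e)) +_) nbrsWithColourExcept-update ⟩
    iverson (does (c ≟ e)) + nbrsWithColourExcept φ x v e ∎
    where open ≡-Reasoning

  nbrsWithColour-update-nonadjacent : ∀ {φ v c x e} → adj G x v ≡ false →
    nbrsWithColour G (φ [ v ≔ c ]) x e ≡ nbrsWithColour G φ x e
  nbrsWithColour-update-nonadjacent {φ} {v} {c} {x} {e} xv = begin
    nbrsWithColour G (φ [ v ≔ c ]) x e
      ≡⟨ nbrsWithColour-split (φ [ v ≔ c ]) x v e ⟩
    iverson (colourClass (φ [ v ≔ c ]) x e v) + nbrsWithColourExcept (φ [ v ≔ c ]) x v e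
      ≡⟨ cong₂ (λ a m → iverson (a ∧ does ((φ [ v ≔ c ]) v ≟ e)) + m) xv nbrsWithColourExcept-update ⟩
    nbrsWithColourExcept φ x v e
      ≡⟨ cong (λ a → iverson (a ∧ does (φ v ≟ e)) + nbrsWithColourExcept φ x v e) xv ⟨
    iverson (colourClass φ x e v) + nbrsWithColourExcept φ x v e
      ≡⟨ nbrsWithColour-split φ x v e ⟨
    nbrsWithColour G φ x e ∎
    where open ≡-Reasoning

  ContainsOddColour : List (Fin k) → (Fin k → ℕ) → Set
  ContainsOddColour L a = (∃[ e ] Odd (a e) × e ∈ L) ⊎ (∀ e → ¬ Odd (a e))

  odd-after-colouring : ∀ {φ x v c L} → adj G x v ≡ true → ContainsOddColour L (nbrsWithColourExcept φ x v) →
    c ∉ L → ∃[ e ] Odd (nbrsWithColour G (φ [ v ≔ c ]) x e)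
  odd-after-colouring {φ} {x} {v} {c} xv (inj₁ (e , odd , e∈L)) c∉L = e , subst Odd (sym unchanged) odd
    where
    unchanged : nbrsWithColour G (φ [ v ≔ c ]) x e ≡ nbrsWithColourExcept φ x v e
    unchanged = trans (nbrsWithColour-update-adjacent xv)
                      (cong (λ b → iverson b + nbrsWithColourExcept φ x v e)
                            (dec-false (c ≟ e) λ { refl → c∉L e∈L }))
  odd-after-colouring {φ} {x} {v} {c} xv (inj₂ none) c∉L = c , subst Odd (sym one-more) (¬odd⇒odd-suc (none c))
    where
    one-more : nbrsWithColour G (φ [ v ≔ c ]) x c ≡ suc (nbrsWithColourExcept φ x v c)
    one-more = trans (nbrsWithColour-update-adjacent xv)
                     (cong (λ b → iverson b + nbrsWithColourExcept φ x v c) (dec-true (c ≟ c) refl))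

  Covers : (Fin n → Fin k) → (Fin n → Bool) → Fin n → List (Fin k) → Set
  Covers φ R v L = (∀ {y} → adj G v y ≡ true → R y ≡ true → φ y ∈ L) ×
                   (∀ {x} → adj G v x ≡ true → Finished R x → ContainsOddColour L (nbrsWithColourExcept φ x v))

  extend : ∀ {R v φ L c} → IsPartialOddColouring (R ─ v) φ → Covers φ R v L → c ∉ L →
    IsPartialOddColouring R (φ [ v ≔ c ])
  extend {R} {v} {φ} {L} {c} (proper , odd) (colours∈L , odd∈L) c∉L = proper′ , odd′
    where
    avoids : ∀ {y} → adj G v y ≡ true → R y ≡ true → c ≢ φ y
    avoids vy Ry c≡φy = c∉L (subst (_∈ L) (sym c≡φy) (colours∈L vy Ry))

    proper′ : ∀ x y → R x ≡ true → R y ≡ true → adj G x y ≡ true → (φ [ v ≔ c ]) x ≢ (φ [ v ≔ c ]) y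
    proper′ x y Rx Ry xy with x ≟ v | y ≟ v
    ... | yes refl | yes refl = contradiction refl (adj⇒≢ xy)
    ... | yes refl | no _ = avoids xy Ry
    ... | no _ | yes refl = avoids (adj-sym xy) Rx ∘ sym
    ... | no x≢v | no y≢v = proper x y (─-true {R = R} Rx x≢v) (─-true {R = R} Ry y≢v) xy

    finished-without-v : ∀ {x} → adj G x v ≡ false → Finished R x → Finished (R ─ v) x
    finished-without-v xv finished z xz = ─-true {R = R} (finished z xz) λ { refl → contradiction (trans (sym xv) xz) λ () }

    odd′ : ∀ x → NonIsolated G x → Finished R x → ∃[ e ] Odd (nbrsWithColour G (φ [ v ≔ c ]) x e)
    odd′ x nonisolated finished with adj G x v in xv
    ... | true = odd-after-colouring xv (odd∈L (adj-sym xv) finished) c∉L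
    ... | false with odd x nonisolated (finished-without-v xv finished)
    ...   | e , oddₑ = e , subst Odd (sym (nbrsWithColour-update-nonadjacent xv)) oddₑ

  full⇒IsOddColouring : ∀ {φ} → IsPartialOddColouring full φ → IsOddColouring G φ
  full⇒IsOddColouring (proper , odd) = (λ x y → proper x y refl refl) , (λ x nonisolated → odd x nonisolated λ _ _ → refl)

  oddColour : (Fin k → ℕ) → List (Fin k)
  oddColour a with any? (λ e → odd? (a e))
  ... | yes (e , _) = e ∷ []
  ... | no _ = []

  oddColour-contains : ∀ a → ContainsOddColour (oddColour a) a
  oddColour-contains a with any? (λ e → odd? (a e))
  ... | yes (e , odd) = inj₁ (e , odd , here refl)
  ... | no none = inj₂ λ e odd → none (e , odd)

  length-oddColour : ∀ a → length (oddColour a) ≤ 1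
  length-oddColour a with any? (λ e → odd? (a e))
  ... | yes _ = ≤-refl
  ... | no _ = z≤n

  ContainsOddColour-⊆ : ∀ {L L′ a} → (∀ {e} → e ∈ L → e ∈ L′) →
    ContainsOddColour L a → ContainsOddColour L′ a
  ContainsOddColour-⊆ L⊆L′ (inj₁ (e , odd , e∈L)) = inj₁ (e , odd , L⊆L′ e∈L)
  ContainsOddColour-⊆ L⊆L′ (inj₂ none) = inj₂ none

  colouredNeighbours : (Fin n → Bool) → Fin n → List (Fin n)
  colouredNeighbours S v = filter (λ y → S y Bool.≟ true) (neighbours v)

  finishedNeighbours : (Fin n → Bool) → Fin n → List (Fin n)
  finishedNeighbours R v = filter (finished? R) (neighbours v)

  standardCover : (Fin n → Fin k) → (Fin n → Bool) → (Fin n → Bool) → Fin n → List (Fin k)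
  standardCover φ S R v =
    map φ (colouredNeighbours S v) ++ concatMap (λ x → oddColour (nbrsWithColourExcept φ x v)) (finishedNeighbours R v)

  colour∈standardCover : ∀ {φ S R v y} → adj G v y ≡ true → S y ≡ true → φ y ∈ standardCover φ S R v
  colour∈standardCover {φ} {S} vy Sy =
    ∈-++⁺ˡ (∈-map⁺ φ (∈-filter⁺ (λ y → S y Bool.≟ true) (∈-neighbours⁺ vy) Sy))

  standardCover-contains-odd : ∀ {φ S R v x} → adj G v x ≡ true → Finished R x →
    ContainsOddColour (standardCover φ S R v) (nbrsWithColourExcept φ x v)
  standardCover-contains-odd {φ} {S} {R} {v} {x} vx finished =
    ContainsOddColour-⊆ (∈-++⁺ʳ (map φ (colouredNeighbours S v)) ∘ ∈-concatMap⁺ oddColourOf ∘ lose x∈finished)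
                        (oddColour-contains (nbrsWithColourExcept φ x v))
    where
    oddColourOf : Fin n → List (Fin k)
    oddColourOf x = oddColour (nbrsWithColourExcept φ x v)
    x∈finished : x ∈ finishedNeighbours R v
    x∈finished = ∈-filter⁺ (finished? R) (∈-neighbours⁺ vx) finished

  standardCover-covers : ∀ {φ R v} → Covers φ R v (standardCover φ R R v)
  standardCover-covers = colour∈standardCover , standardCover-contains-odd

  standardCover-length : ∀ φ S R v →
    length (standardCover φ S R v) ≤ length (colouredNeighbours S v) + length (finishedNeighbours R v)
  standardCover-length φ S R v = begin
    length (standardCover φ S R v)  ≡⟨ length-++ (map φ (colouredNeighbours S v)) ⟩
    length (map φ (colouredNeighbours S v)) + length (concatMap oddColourOf (finishedNeighbours R v))
      ≤⟨ +-mono-≤ (≤-reflexive (length-map φ (colouredNeighbours S v)))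
                  (length-concatMap (finishedNeighbours R v)) ⟩
    length (colouredNeighbours S v) + length (finishedNeighbours R v)  ∎
    where
    open ≤-Reasoning
    oddColourOf : Fin n → List (Fin k)
    oddColourOf x = oddColour (nbrsWithColourExcept φ x v)
    length-concatMap : ∀ xs → length (concatMap oddColourOf xs) ≤ length xs
    length-concatMap [] = z≤n
    length-concatMap (x ∷ xs) = begin
      length (oddColourOf x ++ concatMap oddColourOf xs)  ≡⟨ length-++ (oddColourOf x) ⟩
      length (oddColourOf x) + length (concatMap oddColourOf xs)
        ≤⟨ +-mono-≤ (length-oddColour _) (length-concatMap xs) ⟩
      suc (length xs)  ∎

  length-colouredNeighbours : ∀ S v → length (colouredNeighbours S v) ≤ deg G v
  length-colouredNeighbours S v = length-filter (λ y → S y Bool.≟ true) (neighbours v)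

  length-colouredNeighbours-< : ∀ {S v y} → adj G v y ≡ true → S y ≡ false →
    length (colouredNeighbours S v) < deg G v
  length-colouredNeighbours-< {S} {v} vy Sy =
    filter-notAll (λ y → S y Bool.≟ true) (neighbours v)
                  (lose (∈-neighbours⁺ vy) λ Sy≡true → contradiction (trans (sym Sy) Sy≡true) λ ())

  length-finishedNeighbours : ∀ R v → length (finishedNeighbours R v) ≤ deg G v
  length-finishedNeighbours R v = length-filter (finished? R) (neighbours v)

  length-finishedNeighbours-< : ∀ {R v x} → adj G v x ≡ true → ¬ Finished R x →
    length (finishedNeighbours R v) < deg G v
  length-finishedNeighbours-< {R} {v} vx unfinished =
    filter-notAll (finished? R) (neighbours v) (lose (∈-neighbours⁺ vx) unfinished)

  Exposed : (Fin n → Bool) → Fin n → Set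
  Exposed R v = (∃[ y ] adj G v y ≡ true × R y ≡ false) ⊎ (∃[ x ] adj G v x ≡ true × ¬ Finished R x)

  exposed-cover-short : ∀ {R v} → Exposed R v →
    length (colouredNeighbours R v) + length (finishedNeighbours R v) < 2 * maxDeg G
  exposed-cover-short {R} {v} exposed =
    sum<double (≤-trans (length-colouredNeighbours R v) (deg≤maxDeg v))
               (≤-trans (length-finishedNeighbours R v) (deg≤maxDeg v))
      (Data.Sum.map (λ (_ , vy , Ry) → <-≤-trans (length-colouredNeighbours-< vy Ry) (deg≤maxDeg v))
                    (λ (_ , vx , unfinished) → <-≤-trans (length-finishedNeighbours-< vx unfinished) (deg≤maxDeg v))
                    exposed)

module Greedy {n} (G : Graph n) {k : ℕ} (R₀ : Fin n → Bool) (φ₀ : Fin n → Fin k) where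
  open Neighbourhoods G
  open PartialColourings G {k}

  Extends : (Fin n → Fin k) → Set
  Extends φ = ∀ y → R₀ y ≡ true → φ y ≡ φ₀ y

  Free : (Fin n → Bool) → Fin n → Set
  Free R v = ∀ φ → Extends φ → ∃[ L ] length L < k × Covers φ R v L

  data GreedyOrder (R : Fin n → Bool) : Set where
    precoloured : R ⊆ᵇ R₀ → GreedyOrder R
    colour-last : ∀ v → R₀ v ≡ false → Free R v → GreedyOrder (R ─ v) → GreedyOrder R

  greedy : IsPartialOddColouring R₀ φ₀ → ∀ {R} → GreedyOrder R →
    ∃[ φ ] IsPartialOddColouring R φ × Extends φ
  greedy start (precoloured R⊆R₀) = φ₀ , restrict R⊆R₀ start , λ _ _ → refl
  greedy start (colour-last v R₀v free order) with greedy start order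
  ... | φ , colouring , extends with free φ extends
  ... | L , short , covers with short-list-misses L short
  ... | c , c∉L = φ [ v ≔ c ] , extend colouring covers c∉L , extends′
    where
    extends′ : Extends (φ [ v ≔ c ])
    extends′ y R₀y =
      trans (update-other {φ} {v} {c} {y} λ { refl → contradiction (trans (sym R₀v) R₀y) λ () }) (extends y R₀y)

  oddChromaticLe-of-order : IsPartialOddColouring R₀ φ₀ → GreedyOrder full → OddChromaticLe G k
  oddChromaticLe-of-order start order with greedy start order
  ... | φ , colouring , _ = φ , full⇒IsOddColouring colouring

  free-of-short-standardCover : ∀ {R v} →
    length (colouredNeighbours R v) + length (finishedNeighbours R v) < k → Free R v
  free-of-short-standardCover {R} {v} short φ _ =
    standardCover φ R R v , ≤-<-trans (standardCover-length φ R R v) short , standardCover-covers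

  fresh : (Fin n → Bool) → Fin n → Bool
  fresh R y = not (R₀ y) ∧ R y

  count-fresh-─ : ∀ {R v} → R₀ v ≡ false → R v ≡ true → count (fresh R) ≡ suc (count (fresh (R ─ v)))
  count-fresh-─ {R} {v} R₀v Rv = begin
    count (fresh R)
      ≡⟨ count-remove (fresh R) v ⟩
    iverson (fresh R v) + count (fresh R ─ v)
      ≡⟨ cong₂ (λ a b → iverson (not a ∧ b) + count (fresh R ─ v)) R₀v Rv ⟩
    suc (count (fresh R ─ v))
      ≡⟨ cong suc (count-cong λ y → ∧-assoc (not (R₀ y)) (R y) _) ⟩
    suc (count (fresh (R ─ v))) ∎
    where open ≡-Reasoning

  no-fresh⇒⊆ : ∀ {R} → ¬ (∃[ u ] fresh R u ≡ true) → R ⊆ᵇ R₀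
  no-fresh⇒⊆ {R} none y Ry with R₀ y in R₀y
  ... | true = refl
  ... | false = contradiction (y , subst (λ b → not b ∧ R y ≡ true) (sym R₀y) Ry) none

  Outside : (Fin n → Bool) → Fin n → Set
  Outside R y = R y ≡ false ⊎ R₀ y ≡ true

  fresh⇒¬outside : ∀ {R u} → fresh R u ≡ true → ¬ Outside R u
  fresh⇒¬outside {R} {u} fresh-u (inj₁ Ru) =
    contradiction (trans (sym (∧-zeroʳ (not (R₀ u)))) (trans (cong (not (R₀ u) ∧_) (sym Ru)) fresh-u)) λ ()
  fresh⇒¬outside {R} {u} fresh-u (inj₂ R₀u) =
    contradiction (trans (cong (λ b → not b ∧ R u) (sym R₀u)) fresh-u) λ ()

  ¬outside⇒fresh : ∀ {R v} → ¬ Outside R v → R₀ v ≡ false × R v ≡ true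
  ¬outside⇒fresh {R} {v} inside with R₀ v in R₀v | R v in Rv
  ... | false | true = refl , refl
  ... | true | _ = contradiction (inj₂ refl) inside
  ... | false | false = contradiction (inj₁ refl) inside

  PrecolouredUnfinished : (Fin n → Bool) → Set
  PrecolouredUnfinished R = ∀ r → R₀ r ≡ true → ¬ Finished R r

  module _ (conn : Connected G)
    (exposed-short : ∀ {R v} → Exposed R v →
                     length (colouredNeighbours R v) + length (finishedNeighbours R v) < k) where

    exposed-fresh-vertex : ∀ {R} → PrecolouredUnfinished R → (∃[ z ] R z ≡ false) → (∃[ u ] fresh R u ≡ true) →
      ∃[ v ] R₀ v ≡ false × R v ≡ true × Exposed R v
    exposed-fresh-vertex {R} unfinished (z , Rz) (u , fresh-u)
      with crossing (λ y → (R y Bool.≟ false) ⊎-dec (R₀ y Bool.≟ true)) (conn z u) (inj₁ Rz)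
                    (fresh⇒¬outside {R} fresh-u)
    ... | x , v , xv , outside-x , inside-v with ¬outside⇒fresh {R} inside-v
    ...   | R₀v , Rv = v , R₀v , Rv , exposure outside-x
      where
      exposure : Outside R x → Exposed R v
      exposure (inj₁ Rx) = inj₁ (x , adj-sym xv , Rx)
      exposure (inj₂ R₀x) = inj₂ (x , adj-sym xv , unfinished x R₀x)

    greedyOrder′ : ∀ m R → count (fresh R) ≡ m → PrecolouredUnfinished R → (∃[ z ] R z ≡ false) →
      GreedyOrder R
    greedyOrder′ m R measure unfinished uncoloured with any? (λ u → fresh R u Bool.≟ true)
    ... | no none = precoloured (no-fresh⇒⊆ none)
    ... | yes some with exposed-fresh-vertex unfinished uncoloured some
    ...   | v , R₀v , Rv , exposed with m | trans (sym measure) (count-fresh-─ R₀v Rv)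
    ...     | suc m′ | measure′ = colour-last v R₀v (free-of-short-standardCover (exposed-short exposed))
      (greedyOrder′ m′ (R ─ v) (suc-injective (sym measure′))
        (λ r R₀r → unfinished r R₀r ∘ Finished-mono (─⊆ R v))
        (Data.Product.map₂ (cong (_∧ _)) uncoloured))

    greedyOrder : ∀ {R} → PrecolouredUnfinished R → (∃[ z ] R z ≡ false) → GreedyOrder R
    greedyOrder {R} = greedyOrder′ _ R refl

next : Fin 5 → Fin 5
next zero = suc zero
next (suc zero) = suc (suc zero)
next (suc (suc zero)) = suc (suc (suc zero))
next (suc (suc (suc zero))) = suc (suc (suc (suc zero)))
next (suc (suc (suc (suc zero)))) = zero

prev : Fin 5 → Fin 5
prev i = next (next (next (next i)))

next-prev : ∀ i → next (prev i) ≡ i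
next-prev = from-yes (all? λ i → next (prev i) ≟ i)

c5adj-next : ∀ i → c5adj i (next i) ≡ true
c5adj-next = from-yes (all? λ i → c5adj i (next i) Bool.≟ true)

c5adj-prev : ∀ i → c5adj i (prev i) ≡ true
c5adj-prev = from-yes (all? λ i → c5adj i (prev i) Bool.≟ true)

c5adj⇒next : ∀ i j → c5adj i j ≡ true → j ≡ next i ⊎ i ≡ next j
c5adj⇒next = from-yes (all? λ i → all? λ j →
  (c5adj i j Bool.≟ true) →-dec ((j ≟ next i) ⊎-dec (i ≟ next j)))

distinct⇒within-two : ∀ i j → i ≢ j → j ≡ next i ⊎ i ≡ next j ⊎ j ≡ next (next i) ⊎ i ≡ next (next j)
distinct⇒within-two = from-yes (all? λ i → all? λ j →
  ¬? (i ≟ j) →-dec ((j ≟ next i) ⊎-dec (i ≟ next j) ⊎-dec (j ≟ next (next i)) ⊎-dec (i ≟ next (next j))))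

module FiveCycle {n} (G : Graph n) (conn : Connected G) (v : Fin 5 → Fin n)
  (cycle-edge : ∀ i → adj G (v i) (v (next i)) ≡ true)
  (two-apart-distinct : ∀ i → v i ≢ v (next (next i)))
  (deg≡2 : ∀ i → deg G (v i) ≡ 2) where
  open Neighbourhoods G

  v-injective : ∀ {i j} → v i ≡ v j → i ≡ j
  v-injective {i} {j} vi≡vj with i ≟ j
  ... | yes i≡j = i≡j
  ... | no i≢j with distinct⇒within-two i j i≢j
  ...   | inj₁ refl = contradiction vi≡vj (adj⇒≢ (cycle-edge i))
  ...   | inj₂ (inj₁ refl) = contradiction (sym vi≡vj) (adj⇒≢ (cycle-edge j))
  ...   | inj₂ (inj₂ (inj₁ refl)) = contradiction vi≡vj (two-apart-distinct i)
  ...   | inj₂ (inj₂ (inj₂ refl)) = contradiction (sym vi≡vj) (two-apart-distinct j)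

  v-neighbours : ∀ i {y} → adj G (v i) y ≡ true → y ∈ v (next i) ∷ v (prev i) ∷ []
  v-neighbours i = deg≡2⇒neighbours (deg≡2 i) (cycle-edge i)
    (subst (λ j → adj G (v j) (v (prev i)) ≡ true) (next-prev i) (adj-sym (cycle-edge (prev i))))
    (λ eq → two-apart-distinct (prev i) (trans (sym eq) (cong (v ∘ next) (sym (next-prev i)))))

  v-surjective : ∀ y → ∃[ i ] y ≡ v i
  v-surjective y = ∈-tabulate⁻ (closed-list-complete conn (∈-tabulate⁺ {f = v} zero) closed y)
    where
    closed : ∀ {x y} → x ∈ tabulate v → adj G x y ≡ true → y ∈ tabulate v
    closed x∈ xy with ∈-tabulate⁻ {f = v} x∈
    ... | i , refl with v-neighbours i xy
    ...   | here refl = ∈-tabulate⁺ {f = v} (next i)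
    ...   | there (here refl) = ∈-tabulate⁺ {f = v} (prev i)

  adj-v : ∀ i j → adj G (v i) (v j) ≡ c5adj i j
  adj-v i j with c5adj i j in c5 | adj G (v i) (v j) in vivj
  ... | true | true = refl
  ... | false | false = refl
  ... | true | false with c5adj⇒next i j c5
  ...   | inj₁ refl = contradiction (trans (sym vivj) (cycle-edge i)) λ ()
  ...   | inj₂ refl = contradiction (trans (sym vivj) (adj-sym (cycle-edge j))) λ ()
  adj-v i j | false | true with v-neighbours i vivj
  ...   | here vj≡ =
    contradiction (trans (sym c5) (trans (cong (c5adj i) (v-injective vj≡)) (c5adj-next i))) λ ()
  ...   | there (here vj≡) =
    contradiction (trans (sym c5) (trans (cong (c5adj i) (v-injective vj≡)) (c5adj-prev i))) λ ()

  isoC5 : IsoC5 G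
  isoC5 = mk↔ₛ′ index v index∘v v∘index , λ x y →
    subst₂ (λ x′ y′ → adj G x′ y′ ≡ c5adj (index x) (index y)) (v∘index x) (v∘index y)
           (adj-v (index x) (index y))
    where
    index : Fin n → Fin 5
    index y = proj₁ (v-surjective y)
    v∘index : ∀ y → v (index y) ≡ y
    v∘index y = sym (proj₂ (v-surjective y))
    index∘v : ∀ i → index (v i) ≡ i
    index∘v i = v-injective (v∘index (v i))

oddChromaticLe-of-few-vertices : ∀ {n k} (G : Graph n) → n ≤ k → OddChromaticLe G k
oddChromaticLe-of-few-vertices {n} {k} G n≤k = φ , proper , odd
  where
  open Neighbourhoods G
  open PartialColourings G {k}
  φ : Fin n → Fin k
  φ x = inject≤ x n≤k
  φ-injective : ∀ {x y} → φ x ≡ φ y → x ≡ y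
  φ-injective = inject≤-injective n≤k n≤k _ _
  proper : ∀ x y → adj G x y ≡ true → φ x ≢ φ y
  proper x y xy = adj⇒≢ xy ∘ φ-injective
  odd : ∀ x → NonIsolated G x → ∃[ c ] Odd (nbrsWithColour G φ x c)
  odd x (y , xy) = φ y , subst Odd (sym (trans (nbrsWithColour≡count φ x (φ y)) (count-≡1 y∈class only-y))) one
    where
    y∈class : colourClass φ x (φ y) y ≡ true
    y∈class = cong₂ _∧_ xy (dec-true (φ y ≟ φ y) refl)
    only-y : ∀ z → colourClass φ x (φ y) z ≡ true → z ≡ y
    only-y z xz∧φz≡φy = φ-injective (does⇒ (φ z ≟ φ y) (proj₂ (∧≡true xz∧φz≡φy)))

someColour : ∀ {m} → 0 < m → Fin (2 * m)
someColour {suc m} _ = zero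

oddChromaticLe-of-low-degree : ∀ {n} (G : Graph n) → Connected G → ∀ {w} → deg G w < maxDeg G →
  OddChromaticLe G (2 * maxDeg G)
oddChromaticLe-of-low-degree G conn {w} low = oddChromaticLe-of-order empty-precolouring
  (colour-last w refl (free-of-short-standardCover short)
    (greedyOrder conn exposed-cover-short (λ _ ()) (w , ─-self _ w)))
  where
  open Neighbourhoods G
  open PartialColourings G {2 * maxDeg G}
  open Greedy G empty (λ _ → someColour (≤-<-trans z≤n low))
  coloured<Δ : length (colouredNeighbours full w) < maxDeg G
  coloured<Δ = ≤-<-trans (length-colouredNeighbours _ w) low
  short : length (colouredNeighbours full w) + length (finishedNeighbours full w) < 2 * maxDeg G
  short = sum<double (<⇒≤ coloured<Δ) (≤-trans (length-finishedNeighbours _ w) (<⇒≤ low)) (inj₁ coloured<Δ)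

-- With minimum degree 3, the two ends of a cherry can share a colour, since no vertex has all its
-- neighbours among them; the centre, coloured last, then sees at most 2Δ - 1 forbidden colours.
oddChromaticLe-of-cherry : ∀ {n} (G : Graph n) → Connected G → (∀ x → 3 ≤ deg G x) →
  ∀ {w p q} → Neighbourhoods.Cherry G w p q → OddChromaticLe G (2 * maxDeg G)
oddChromaticLe-of-cherry G conn min-deg {w} {p} {q} (wp , wq , pq , p≢q) =
  oddChromaticLe-of-order start
    (colour-last w R₀w free-w (greedyOrder conn exposed-cover-short unfinished (w , ─-self full w)))
  where
  open Neighbourhoods G
  open PartialColourings G {2 * maxDeg G}
  c₀ = someColour (≤-trans (s≤s z≤n) (≤-trans (min-deg w) (deg≤maxDeg w)))
  open Greedy G ⟦ p ∷ q ∷ [] ⟧ (λ _ → c₀)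

  start : IsPartialOddColouring ⟦ p ∷ q ∷ [] ⟧ (λ _ → c₀)
  start = pair-precolouring c₀ pq λ x finished →
    contradiction (≤-trans (min-deg x) (deg≤-of-neighbours⊆ (p ∷ q ∷ []) (finished-⟦⟧ finished)))
                  λ { (s≤s (s≤s ())) }

  R₀w : ⟦ p ∷ q ∷ [] ⟧ w ≡ false
  R₀w = dec-false (w ∈? p ∷ q ∷ [])
    λ { (here refl) → adj⇒≢ wp refl ; (there (here refl)) → adj⇒≢ wq refl }

  free-w : Free full w
  free-w φ extends = L , short , coloured∈ , standardCover-contains-odd
    where
    φq≡φp : φ q ≡ φ p
    φq≡φp = trans (extends q (dec-true (q ∈? p ∷ q ∷ []) (there (here refl))))
                  (sym (extends p (dec-true (p ∈? p ∷ q ∷ []) (here refl))))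
    L : List (Fin (2 * maxDeg G))
    L = standardCover φ (full ─ q) full w
    coloured∈ : ∀ {y} → adj G w y ≡ true → full y ≡ true → φ y ∈ L
    coloured∈ {y} wy _ with y ≟ q
    ... | yes refl =
      subst (_∈ L) (sym φq≡φp) (colour∈standardCover {φ} {full ─ q} {full} wp (─-true {R = full} refl p≢q))
    ... | no y≢q = colour∈standardCover {φ} {full ─ q} {full} wy (─-true {R = full} refl y≢q)
    coloured<Δ : length (colouredNeighbours (full ─ q) w) < maxDeg G
    coloured<Δ = <-≤-trans (length-colouredNeighbours-< wq (─-self _ q)) (deg≤maxDeg w)
    short : length L < 2 * maxDeg G
    short = ≤-<-trans (standardCover-length φ _ _ w)
      (sum<double (<⇒≤ coloured<Δ) (≤-trans (length-finishedNeighbours _ w) (deg≤maxDeg w)) (inj₁ coloured<Δ))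

  unfinished : PrecolouredUnfinished (full ─ w)
  unfinished r R₀r finished with does⇒ (r ∈? p ∷ q ∷ []) R₀r
  ... | here refl = contradiction (trans (sym (─-self _ w)) (finished w (adj-sym wp))) λ ()
  ... | there (here refl) = contradiction (trans (sym (─-self _ w)) (finished w (adj-sym wq))) λ ()

-- A connected 2-regular graph on more than four vertices is a cycle C_m with m ≥ 5. The ends p and c
-- of the path p w q c are adjacent only if m = 4 and have a common neighbour only if m = 5, so here
-- they can be precoloured alike. Coloured last, w must avoid only the colours of p and q and an odd
-- class at p: the odd class at q is the colour of c, which is that of p.
module Cycle {n} (G : Graph n) (conn : Connected G) (not-C5 : ¬ IsoC5 G) (4<n : 4 < n)
  (deg≡2 : ∀ x → deg G x ≡ 2) (Δ≡2 : maxDeg G ≡ 2) {w p q c : Fin n}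
  (wp : adj G w p ≡ true) (wq : adj G w q ≡ true) (pq : adj G p q ≡ false) (p≢q : p ≢ q)
  (qc : adj G q c ≡ true) (c≢w : c ≢ w) where
  open Neighbourhoods G
  open PartialColourings G {2 * maxDeg G}

  N-w : ∀ {y} → adj G w y ≡ true → y ∈ p ∷ q ∷ []
  N-w = deg≡2⇒neighbours (deg≡2 w) wp wq p≢q

  N-q : ∀ {y} → adj G q y ≡ true → y ∈ c ∷ w ∷ []
  N-q = deg≡2⇒neighbours (deg≡2 q) qc (adj-sym wq) c≢w

  p≢c : p ≢ c
  p≢c refl = contradiction (trans (sym (adj-sym pq)) qc) λ ()

  p≁c : adj G p c ≡ false
  p≁c with adj G p c in pc
  ... | false = refl
  ... | true = contradiction (complete-list-length (closed-list-complete conn (here refl) closed)) (<⇒≱ 4<n)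
    where
    N-p : ∀ {y} → adj G p y ≡ true → y ∈ w ∷ c ∷ []
    N-p = deg≡2⇒neighbours (deg≡2 p) (adj-sym wp) pc (c≢w ∘ sym)
    N-c : ∀ {y} → adj G c y ≡ true → y ∈ q ∷ p ∷ []
    N-c = deg≡2⇒neighbours (deg≡2 c) (adj-sym qc) (adj-sym pc) (p≢q ∘ sym)
    closed : ∀ {x y} → x ∈ w ∷ p ∷ q ∷ c ∷ [] → adj G x y ≡ true → y ∈ w ∷ p ∷ q ∷ c ∷ []
    closed (here refl) xy with N-w xy
    ... | here refl = there (here refl)
    ... | there (here refl) = there (there (here refl))
    closed (there (here refl)) xy with N-p xy
    ... | here refl = here refl
    ... | there (here refl) = there (there (there (here refl)))
    closed (there (there (here refl))) xy with N-q xy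
    ... | here refl = there (there (there (here refl)))
    ... | there (here refl) = here refl
    closed (there (there (there (here refl)))) xy with N-c xy
    ... | here refl = there (there (here refl))
    ... | there (here refl) = there (here refl)

  no-common-neighbour : ∀ {b} → adj G b p ≡ true → adj G b c ≡ true → ⊥
  no-common-neighbour {b} bp bc = not-C5 (FiveCycle.isoC5 G conn v edge two-apart-distinct (λ i → deg≡2 (v i)))
    where
    v : Fin 5 → Fin n
    v zero = w
    v (suc zero) = p
    v (suc (suc zero)) = b
    v (suc (suc (suc zero))) = c
    v (suc (suc (suc (suc zero)))) = q
    edge : ∀ i → adj G (v i) (v (next i)) ≡ true
    edge zero = wp
    edge (suc zero) = adj-sym bp
    edge (suc (suc zero)) = bc
    edge (suc (suc (suc zero))) = adj-sym qc
    edge (suc (suc (suc (suc zero)))) = adj-sym wq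
    two-apart-distinct : ∀ i → v i ≢ v (next (next i))
    two-apart-distinct zero refl with N-w bc
    ... | here c≡p = p≢c (sym c≡p)
    ... | there (here c≡q) = adj⇒≢ qc (sym c≡q)
    two-apart-distinct (suc zero) = p≢c
    two-apart-distinct (suc (suc zero)) refl = contradiction (trans (sym (adj-sym pq)) bp) λ ()
    two-apart-distinct (suc (suc (suc zero))) = c≢w
    two-apart-distinct (suc (suc (suc (suc zero)))) = p≢q ∘ sym

  avoids-pair : ∀ {x u u′} → (∀ {y} → adj G x y ≡ true → y ∈ u ∷ u′ ∷ []) → adj G x u ≡ false → ⊥
  avoids-pair {x} {u} {u′} N-x xu =
    contradiction (subst (_≤ 1) (deg≡2 x) (deg≤-of-neighbours⊆ (u′ ∷ []) only-u′)) λ { (s≤s ()) }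
    where
    only-u′ : ∀ {y} → adj G x y ≡ true → y ∈ u′ ∷ []
    only-u′ xy with N-x xy
    ... | here refl = contradiction (trans (sym xu) xy) λ ()
    ... | there y∈ = y∈

  c₀ : Fin (2 * maxDeg G)
  c₀ = someColour (subst (0 <_) (sym Δ≡2) (s≤s z≤n))

  open Greedy G ⟦ p ∷ c ∷ [] ⟧ (λ _ → c₀)

  start : IsPartialOddColouring ⟦ p ∷ c ∷ [] ⟧ (λ _ → c₀)
  start = pair-precolouring c₀ p≁c unfinished
    where
    swap : ∀ {y} → y ∈ p ∷ c ∷ [] → y ∈ c ∷ p ∷ []
    swap (here y≡p) = there (here y≡p)
    swap (there (here y≡c)) = here y≡c
    unfinished : ∀ x → ¬ Finished ⟦ p ∷ c ∷ [] ⟧ x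
    unfinished x finished with adj G x p in xp | adj G x c in xc
    ... | true | true = no-common-neighbour xp xc
    ... | false | _ = avoids-pair (finished-⟦⟧ finished) xp
    ... | true | false = avoids-pair (swap ∘ finished-⟦⟧ finished) xc

  free-w : Free full w
  free-w φ extends = L , short , coloured∈ , odd∈
    where
    L : List (Fin (2 * maxDeg G))
    L = φ p ∷ φ q ∷ oddColour (nbrsWithColourExcept φ p w)
    short : length L < 2 * maxDeg G
    short = subst (λ m → length L < 2 * m) (sym Δ≡2) (s≤s (s≤s (s≤s (length-oddColour _))))
    coloured∈ : ∀ {y} → adj G w y ≡ true → full y ≡ true → φ y ∈ L
    coloured∈ wy _ with N-w wy
    ... | here refl = here refl
    ... | there (here refl) = there (here refl)
    φc≡φp : φ c ≡ φ p
    φc≡φp = trans (extends c (dec-true (c ∈? p ∷ c ∷ []) (there (here refl))))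
                  (sym (extends p (dec-true (p ∈? p ∷ c ∷ []) (here refl))))
    c-alone : nbrsWithColourExcept φ q w (φ c) ≡ 1
    c-alone = count-≡1 (─-true {R = colourClass φ q (φ c)} (cong₂ _∧_ qc (dec-true (φ c ≟ φ c) refl)) c≢w)
                       only-c
      where
      only-c : ∀ y → (colourClass φ q (φ c) ─ w) y ≡ true → y ≡ c
      only-c y in-class with ─-true⁻ {R = colourClass φ q (φ c)} in-class
      ... | class , y≢w with N-q (proj₁ (∧≡true class))
      ...   | here y≡c = y≡c
      ...   | there (here y≡w) = contradiction y≡w y≢w
    odd∈ : ∀ {x} → adj G w x ≡ true → Finished full x → ContainsOddColour L (nbrsWithColourExcept φ x w)
    odd∈ wx _ with N-w wx
    ... | here refl = ContainsOddColour-⊆ (there ∘ there) (oddColour-contains _)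
    ... | there (here refl) = inj₁ (φ c , subst Odd (sym c-alone) one , subst (_∈ L) (sym φc≡φp) (here refl))

  order : GreedyOrder full
  order = colour-last w R₀w free-w
    (colour-last q R₀q (free-of-short-standardCover (exposed-cover-short (inj₁ (w , adj-sym wq , ─-self full w))))
      (greedyOrder conn exposed-cover-short unfinished (w , R-w)))
    where
    R₀w : ⟦ p ∷ c ∷ [] ⟧ w ≡ false
    R₀w = dec-false (w ∈? p ∷ c ∷ [])
      λ { (here w≡p) → adj⇒≢ wp w≡p ; (there (here w≡c)) → c≢w (sym w≡c) }
    R₀q : ⟦ p ∷ c ∷ [] ⟧ q ≡ false
    R₀q = dec-false (q ∈? p ∷ c ∷ [])
      λ { (here q≡p) → p≢q (sym q≡p) ; (there (here q≡c)) → adj⇒≢ qc q≡c }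
    R-w : ((full ─ w) ─ q) w ≡ false
    R-w = cong (_∧ not (does (w ≟ q))) (─-self full w)
    unfinished : PrecolouredUnfinished ((full ─ w) ─ q)
    unfinished r R₀r finished with does⇒ (r ∈? p ∷ c ∷ []) R₀r
    ... | here refl = contradiction (trans (sym R-w) (finished w (adj-sym wp))) λ ()
    ... | there (here refl) = contradiction (trans (sym (─-self (full ─ w) q)) (finished q (adj-sym qc))) λ ()

  oddChromaticLe : OddChromaticLe G (2 * maxDeg G)
  oddChromaticLe = oddChromaticLe-of-order start order

oddChromaticLe-of-cycle : ∀ {n} (G : Graph n) → Connected G → ¬ IsoC5 G → 4 < n →
  (∀ x → deg G x ≡ 2) → maxDeg G ≡ 2 → ∀ {w p q} → Neighbourhoods.Cherry G w p q →
  OddChromaticLe G (2 * maxDeg G)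
oddChromaticLe-of-cycle G conn not-C5 4<n deg≡2 Δ≡2 {w} {p} {q} (wp , wq , pq , p≢q)
  with Neighbourhoods.another-neighbour G (≤-reflexive (sym (deg≡2 q))) w
... | c , qc , c≢w = Cycle.oddChromaticLe G conn not-C5 4<n deg≡2 Δ≡2 wp wq pq p≢q qc c≢w

module _ {n} (G : Graph n) where
  open Neighbourhoods G

  oddChromaticLe-of-regular : Connected G → ¬ IsoC5 G → 2 * maxDeg G < n →
    (∀ z → deg G z ≡ maxDeg G) → ∀ {x y} → adj G x y ≡ true → OddChromaticLe G (2 * maxDeg G)
  oddChromaticLe-of-regular conn not-C5 2Δ<n regular {x} xy
    with cherry-at conn (proj₂ (short-list-misses (x ∷ neighbours x) (closed-neighbourhood-short 2Δ<n xy)))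
  ... | w , q , cherry with maxDeg G ≟ℕ 2
  ...   | yes Δ≡2 = oddChromaticLe-of-cycle G conn not-C5 (subst (λ m → 2 * m < n) Δ≡2 2Δ<n)
                                            (λ z → trans (regular z) Δ≡2) Δ≡2 cherry
  ...   | no Δ≢2 = oddChromaticLe-of-cherry G conn min-deg cherry
    where
    min-deg : ∀ z → 3 ≤ deg G z
    min-deg z =
      subst (3 ≤_) (sym (regular z)) (≤∧≢⇒< (≤-trans (2≤deg-of-cherry cherry) (deg≤maxDeg w)) (Δ≢2 ∘ sym))

corollary3 : ∀ (n : ℕ) (G : Graph n) → Connected G → ¬ IsoC5 G → HasEdge G →
    OddChromaticLe G (2 * maxDeg G)
corollary3 n G conn not-C5 (x , y , xy) with n ≤? 2 * maxDeg G | any? (λ w → deg G w <? maxDeg G)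
... | yes few | _ = oddChromaticLe-of-few-vertices G few
... | no many | yes (w , low) = oddChromaticLe-of-low-degree G conn low
... | no many | no none = oddChromaticLe-of-regular G conn not-C5 (≰⇒> many)
  (λ z → ≤-antisym (Neighbourhoods.deg≤maxDeg G z) (≮⇒≥ λ low → none (z , low))) xy
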